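{- For each $m\in\omega$, the ideal $\widetilde{\mathcal{ED}}_m$ is an $F_\sigma$ tall ideal on $\omega$.
   Context: Fix a family $\{A_s\subseteq\omega: s\in\omega^{<\omega}\}$ such that $A_\emptyset=\omega$, every $A_s$ is infinite, $\{A_{s^\frown n}:n\in\omega\}$ is a partition of $A_s$, and for distinct $n,m\in\omega$ there exist $s\neq t$ in $\omega^{<\omega}$ with $n\in A_s$, $m\in A_t$. Let $\mathcal{B}=\{A\subseteq\omega: \exists s\in\omega^{<\omega}\,(A\subseteq A_s\wedge\forall n\in\omega\ |A\cap A_{s^\frown n}|=1)\}$ and $\mathcal{A}_m=\{A_s: |s|=m+1\}$. $\widetilde{\mathcal{ED}}_m$ is the ideal on $\omega$ generated by $\mathcal{A}_m\cup\mathcal{B}$ (and finite sets). Tall: every infinite subset of $\omega$ has infinite intersection with a member of the ideal. $F_\sigma$ refers to $\mathcal{P}(\omega)\cong 2^\omega$. -}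

module Defs where

open import Data.Nat using (ℕ; zero; suc; _≤_; _<_)
open import Data.Bool using (Bool; true; false; _∧_; _∨_)
open import Data.List using (List; []; _∷_; _∷ʳ_; length)
open import Data.List.Relation.Unary.All using (All)
open import Data.List.Relation.Unary.Any using (Any)
open import Data.Product using (Σ; ∃; _×_; _,_)
open import Data.Sum using (_⊎_)
open import Data.Unit using (⊤)
open import Data.Empty using (⊥)
open import Relation.Nullary using (¬_)
open import Relation.Binary.PropositionalEquality using (_≡_; _≢_)
open import Function.Bundles using (_⇔_)

-- Subsets of ω are identified with points of Cantor space 2^ω = ℕ → Bool.
Subset : Set
Subset = ℕ → Bool

_∈_ : ℕ → Subset → Set
n ∈ X = X n ≡ true

_⊆_ : Subset → Subset → Set
X ⊆ Y = ∀ k → k ∈ X → k ∈ Y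

_∩_ : Subset → Subset → Subset
(X ∩ Y) k = X k ∧ Y k

_∪_ : Subset → Subset → Subset
(X ∪ Y) k = X k ∨ Y k

full : Subset
full _ = true

Finite : Subset → Set
Finite X = ∃ λ N → ∀ k → k ∈ X → k < N

Infinite : Subset → Set
Infinite X = ∀ N → ∃ λ n → N ≤ n × n ∈ X

ExactlyOne : Subset → Set
ExactlyOne X = ∃ λ k → k ∈ X × (∀ j → j ∈ X → j ≡ k)

-- The family {A_s : s ∈ ω^{<ω}}; finite sequences are lists, s⌢n = s ∷ʳ n.

Family : Set
Family = List ℕ → Subset

record IsTreeFamily (A : Family) : Set where
  field
    root     : ∀ k → k ∈ A []
    infinite : ∀ s → Infinite (A s)
    sub      : ∀ s n → A (s ∷ʳ n) ⊆ A s
    cover    : ∀ s k → k ∈ A s → ∃ λ n → k ∈ A (s ∷ʳ n)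
    disjoint : ∀ s n n' k → k ∈ A (s ∷ʳ n) → k ∈ A (s ∷ʳ n') → n ≡ n'
    separate : ∀ n m → n ≢ m →
               ∃ λ s → ∃ λ t → s ≢ t × n ∈ A s × m ∈ A t

InB : Family → Subset → Set
InB A X = ∃ λ s → X ⊆ A s × (∀ n → ExactlyOne (X ∩ A (s ∷ʳ n)))

InAm : Family → ℕ → Subset → Set
InAm A m X = ∃ λ s → length s ≡ suc m × X ≡ A s

Generator : Family → ℕ → Subset → Set
Generator A m X = InAm A m X ⊎ InB A X

-- The ideal generated by 𝒜_m ∪ ℬ and the finite sets: X belongs to it iff
-- X is contained in the union of a finite set {0,…,N-1} and finitely many
-- generators.
EDm : Family → ℕ → Subset → Set
EDm A m X = Σ (List Subset) λ G → All (Generator A m) G ×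
            ∃ λ N → ∀ k → k ∈ X → k < N ⊎ Any (λ g → k ∈ g) G

record IsIdeal (I : Subset → Set) : Set where
  field
    downward : ∀ X Y → I Y → X ⊆ Y → I X
    union    : ∀ X Y → I X → I Y → I (X ∪ Y)
    finite   : ∀ X → Finite X → I X
    proper   : ¬ I full

Tall : (Subset → Set) → Set
Tall I = ∀ X → Infinite X → ∃ λ Y → I Y × Infinite (X ∩ Y)

_≺_ : List Bool → Subset → Set
[] ≺ x = ⊤
(b ∷ s) ≺ x = x 0 ≡ b × (s ≺ λ n → x (suc n))

IsOpen : (Subset → Set) → Set₁
IsOpen U = Σ (List Bool → Set) λ S → ∀ x → U x ⇔ (∃ λ s → S s × s ≺ x)

IsClosed : (Subset → Set) → Set₁
IsClosed C = IsOpen (λ x → ¬ C x)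

IsFσ : (Subset → Set) → Set₁
IsFσ F = Σ (ℕ → Subset → Set) λ C → (∀ k → IsClosed (C k)) ×
         (∀ x → F x ⇔ (∃ λ k → C k x))

-- Properness: choose a node u of length m + 1 + K off the generating level-(m+1) nodes and
-- deeper than every generating root. On the infinite set A_u ∖ [0, N) each generator has at most
-- one point, so finitely many generators cannot cover it.
-- Tallness: if X meets some A_s with |s| = m + 1 infinitely, take A_s. Otherwise descend to a node
-- s with X ∩ A_s infinite but X finite in every child of s; a B-set through a point of X in each
-- child that meets X then meets X infinitely often.
-- F_σ: X lies in the ideal iff for some (N, S, R, j), X ⊆ [0, N) ∪ ⋃_{s ∈ S} A_s ∪ ⋃_{r ∈ R} A_r
-- and, sending each remaining point to its deepest r ∈ R, no child of r receives more than j
-- points (j B-sets per root then suffice, the i-th picking the point of rank i in each child).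
-- For fixed parameters this condition is closed, and there are countably many parameters.
module Submission where

open import Axiom.ExcludedMiddle using (ExcludedMiddle)
open import Data.Bool using (Bool; true; false; _∧_; not; if_then_else_)
open import Data.Bool.Properties using (∧-conicalˡ; ∧-conicalʳ)
open import Data.Empty using (⊥)
open import Data.List using (List; []; _∷_; _∷ʳ_; _++_; length; replicate; map; upTo; cartesianProduct)
open import Data.List.Membership.Propositional using (lose) renaming (_∈_ to _∈ˡ_)
open import Data.List.Membership.Propositional.Properties using (∈-cartesianProduct⁺; ∈-upTo⁺)
open import Data.List.Properties using (length-++; length-replicate; ++-identityʳ; ∷ʳ-++)
open import Data.List.Relation.Unary.All as All using (All; []; _∷_)
open import Data.List.Relation.Unary.All.Properties using (++⁺; ¬Any⇒All¬) renaming (map⁺ to All-map⁺)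
open import Data.List.Relation.Unary.Any using (Any; here; there)
open import Data.List.Relation.Unary.Any.Properties using (++⁺ˡ; ++⁺ʳ) renaming (map⁺ to Any-map⁺)
open import Data.List.Reverse using (Reverse; []; _∶_∶ʳ_; reverseView)
open import Data.Nat using (ℕ; zero; suc; _+_; _⊔_; _≤_; _<_; _≤?_; _<?_; z≤n; s≤s)
open import Data.Nat.ListAction using (sum)
open import Data.Nat.Properties
open import Data.Product using (∃; _×_; _,_; proj₁; proj₂; uncurry)
open import Data.Product.Function.NonDependent.Propositional using (_×-↠_)
open import Data.Sum as Sum using (_⊎_; inj₁; inj₂)
open import Data.Unit using (tt)
open import Function using (case_of_)
open import Function.Bundles using (_↠_; mk↠ₛ; Surjection; mk⇔)
open import Function.Construct.Composition using (_↠-∘_)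
open import Function.Construct.Identity using (↠-id)
open import Level using (0ℓ)
open import Relation.Binary.Definitions using (tri<; tri≈; tri>)
open import Relation.Binary.PropositionalEquality using (_≡_; _≢_; refl; sym; trans; cong; cong₂; subst)
open import Relation.Nullary using (¬_; Dec; yes; no; does; contradiction)

open import Defs

_∉_ : ℕ → Subset → Set
k ∉ X = ¬ k ∈ X

infixl 20 _∖_
_∖_ : Subset → Subset → Subset
(X ∖ Y) k = X k ∧ not (Y k)

AtMostOne : Subset → Set
AtMostOne X = ∀ a b → a ∈ X → b ∈ X → a ≡ b

∈-∩⁺ : ∀ {X Y k} → k ∈ X → k ∈ Y → k ∈ (X ∩ Y)
∈-∩⁺ k∈X k∈Y = cong₂ _∧_ k∈X k∈Y

∈-∩⁻ : ∀ {X Y k} → k ∈ (X ∩ Y) → k ∈ X × k ∈ Y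
∈-∩⁻ {X} {Y} {k} k∈X∩Y = ∧-conicalˡ (X k) (Y k) k∈X∩Y , ∧-conicalʳ (X k) (Y k) k∈X∩Y

∈-∖⁻ : ∀ {X Y k} → k ∈ (X ∖ Y) → k ∈ X × k ∉ Y
∈-∖⁻ {X} {Y} {k} k∈X∖Y with X k | Y k
... | true | false = refl , λ ()

atMostOne-⊆ : ∀ {X Y} → X ⊆ Y → AtMostOne Y → AtMostOne X
atMostOne-⊆ X⊆Y one a b a∈X b∈X = one a b (X⊆Y a a∈X) (X⊆Y b b∈X)

count : Subset → ℕ → ℕ
count X zero = 0
count X (suc L) = if X L then suc (count X L) else count X L

count-suc-∈ : ∀ X {n} → n ∈ X → count X (suc n) ≡ suc (count X n)
count-suc-∈ X n∈X rewrite n∈X = refl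

count-≤-suc : ∀ X L → count X L ≤ count X (suc L)
count-≤-suc X L with X L
... | true = n≤1+n (count X L)
... | false = ≤-refl

count-split : ∀ X Y L → count X L ≡ count (Y ∩ X) L + count (X ∖ Y) L
count-split X Y zero = refl
count-split X Y (suc L) with X L | Y L
... | true | true = cong suc (count-split X Y L)
... | true | false = trans (cong suc (count-split X Y L)) (sym (+-suc _ _))
... | false | true = count-split X Y L
... | false | false = count-split X Y L

count-mono : ∀ X {L L'} → L ≤ L' → count X L ≤ count X L'
count-mono X {L' = zero} z≤n = ≤-refl
count-mono X {L} {suc L'} L≤1+L' with m≤n⇒m<n∨m≡n L≤1+L'
... | inj₂ refl = ≤-refl
... | inj₁ (s≤s L≤L') = ≤-trans (count-mono X L≤L') (count-≤-suc X L')

count-ext : ∀ {X Y} L → (∀ k → k < L → X k ≡ Y k) → count X L ≡ count Y L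
count-ext zero X≗Y = refl
count-ext {X} {Y} (suc L) X≗Y
  rewrite X≗Y L ≤-refl | count-ext L (λ k k<L → X≗Y k (m<n⇒m<1+n k<L)) = refl

count-empty : ∀ {X} L → (∀ k → k < L → k ∉ X) → count X L ≡ 0
count-empty zero X-empty = refl
count-empty {X} (suc L) X-empty with X L in L∈X
... | true = contradiction L∈X (X-empty L ≤-refl)
... | false = count-empty L (λ k k<L → X-empty k (m<n⇒m<1+n k<L))

count-≤1 : ∀ {X} → AtMostOne X → ∀ L → count X L ≤ 1
count-≤1 one zero = z≤n
count-≤1 {X} one (suc L) with X L in L∈X
... | true = s≤s (≤-reflexive (count-empty L (λ k k<L k∈X → <⇒≢ k<L (one k L k∈X L∈X))))
... | false = count-≤1 one L

count-< : ∀ {X a b} → a ∈ X → a < b → count X a < count X b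
count-< {X} {a} a∈X a<b = ≤-trans (≤-reflexive (sym (count-suc-∈ X a∈X))) (count-mono X a<b)

count-injective : ∀ {X a b} → a ∈ X → b ∈ X → count X a ≡ count X b → a ≡ b
count-injective {a = a} {b} a∈X b∈X eq with <-cmp a b
... | tri< a<b _ _ = contradiction eq (<⇒≢ (count-< a∈X a<b))
... | tri≈ _ a≡b _ = a≡b
... | tri> _ _ b<a = contradiction (sym eq) (<⇒≢ (count-< b∈X b<a))

count-unbounded : ∀ {X} → Infinite X → ∀ M → ∃ λ L → M ≤ count X L
count-unbounded inf zero = 0 , z≤n
count-unbounded {X} inf (suc M) with count-unbounded inf M
... | L , M≤ with inf L
... | n , L≤n , n∈X = suc n , (begin
  suc M               ≤⟨ s≤s (≤-trans M≤ (count-mono X L≤n)) ⟩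
  suc (count X n)     ≡⟨ sym (count-suc-∈ X n∈X) ⟩
  count X (suc n)     ∎)
  where open ≤-Reasoning

count-cover : ∀ G {P} → All (λ g → AtMostOne (g ∩ P)) G →
              (∀ k → k ∈ P → Any (k ∈_) G) → ∀ L → count P L ≤ length G
count-cover [] _ covered L = ≤-reflexive (count-empty L (λ k _ k∈P → case (covered k k∈P)))
  where case : ∀ {k} → Any (k ∈_) [] → ⊥
        case ()
count-cover (g ∷ G) {P} (one ∷ ones) covered L = begin
  count P L                          ≡⟨ count-split P g L ⟩
  count (g ∩ P) L + count (P ∖ g) L  ≤⟨ +-mono-≤ (count-≤1 one L)
                                                 (count-cover G ones′ covered′ L) ⟩
  suc (length G)                     ∎
  where
  open ≤-Reasoning
  P∖g⊆P : ∀ {h} → (h ∩ (P ∖ g)) ⊆ (h ∩ P)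
  P∖g⊆P {h} k k∈ = let k∈h , k∈P∖g = ∈-∩⁻ {h} {P ∖ g} k∈
                   in ∈-∩⁺ {h} {P} k∈h (proj₁ (∈-∖⁻ {P} {g} k∈P∖g))
  ones′ : All (λ h → AtMostOne (h ∩ (P ∖ g))) G
  ones′ = All.map (atMostOne-⊆ P∖g⊆P) ones
  covered′ : ∀ k → k ∈ (P ∖ g) → Any (k ∈_) G
  covered′ k k∈P∖g with ∈-∖⁻ {P} {g} k∈P∖g | covered k (proj₁ (∈-∖⁻ {P} {g} k∈P∖g))
  ... | _ , k∉g | here k∈g = contradiction k∈g k∉g
  ... | _ | there k∈G = k∈G

infinite-uncoverable : ∀ {P} G → Infinite P → All (λ g → AtMostOne (g ∩ P)) G →
                    ¬ (∀ k → k ∈ P → Any (k ∈_) G)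
infinite-uncoverable G inf ones covered with count-unbounded inf (suc (length G))
... | L , bound = <⇒≱ bound (count-cover G ones covered L)

nextOnDiagonal : ℕ × ℕ → ℕ × ℕ
nextOnDiagonal (a , zero) = 0 , suc a
nextOnDiagonal (a , suc b) = suc a , b

unpair : ℕ → ℕ × ℕ
unpair zero = 0 , 0
unpair (suc k) = nextOnDiagonal (unpair k)

unpair-surjective : ∀ p → ∃ λ k → unpair k ≡ p
unpair-surjective (a , b) = walk (a + b) a b refl
  where
  walk : ∀ d a b → a + b ≡ d → ∃ λ k → unpair k ≡ (a , b)
  walk d zero zero _ = 0 , refl
  walk d (suc a) b a+b≡d with walk d a (suc b) (trans (+-suc a b) a+b≡d)
  ... | k , eq = suc k , cong nextOnDiagonal eq
  walk (suc d) zero (suc b) b≡d with walk d b zero (trans (+-identityʳ b) (suc-injective b≡d))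
  ... | k , eq = suc k , cong nextOnDiagonal eq

ℕ↠ℕ×ℕ : ℕ ↠ (ℕ × ℕ)
ℕ↠ℕ×ℕ = mk↠ₛ unpair-surjective

ℕ↠-× : ∀ {X Y : Set} → ℕ ↠ X → ℕ ↠ Y → ℕ ↠ (X × Y)
ℕ↠-× f g = (f ×-↠ g) ↠-∘ ℕ↠ℕ×ℕ

ℕ↠-List : ∀ {X : Set} → ℕ ↠ X → ℕ ↠ List X
ℕ↠-List {X} f = mk↠ₛ {to = λ k → decode (proj₁ (unpair k)) (proj₂ (unpair k))} onto
  where
  open Surjection f using (to; to⁻; to∘to⁻)
  decode : ℕ → ℕ → List X
  decode zero _ = []
  decode (suc l) k = to (proj₁ (unpair k)) ∷ decode l (proj₂ (unpair k))
  encode : ∀ xs → ∃ λ k → decode (length xs) k ≡ xs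
  encode [] = 0 , refl
  encode (x ∷ xs) with encode xs
  ... | k , decode≡xs with unpair-surjective (to⁻ x , k)
  ... | c , unpair-c = c , cong₂ _∷_
    (trans (cong (λ p → to (proj₁ p)) unpair-c) (to∘to⁻ x))
    (trans (cong (λ p → decode (length xs) (proj₂ p)) unpair-c) decode≡xs)
  onto : ∀ xs → ∃ λ k → decode (proj₁ (unpair k)) (proj₂ (unpair k)) ≡ xs
  onto xs with encode xs
  ... | k , decode≡xs with unpair-surjective (length xs , k)
  ... | c , unpair-c = c , trans (cong (λ p → decode (proj₁ p) (proj₂ p)) unpair-c) decode≡xs

upperBound : ∀ (f : ℕ → ℕ) K → ∃ λ M → ∀ k → k < K → f k ≤ M
upperBound f zero = 0 , λ _ ()
upperBound f (suc K) with upperBound f K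
... | M , bound = M ⊔ f K , λ k k<1+K → case m≤n⇒m<n∨m≡n (≤-pred k<1+K) of λ where
  (inj₁ k<K) → ≤-trans (bound k k<K) (m≤m⊔n M (f K))
  (inj₂ refl) → m≤n⊔m M (f K)

strictUpperBound : ∀ {X : Set} (f : X → ℕ) xs → ∃ λ M → All (λ x → f x < M) xs
strictUpperBound f [] = 0 , []
strictUpperBound f (x ∷ xs) with strictUpperBound f xs
... | M , below =
  suc (f x) ⊔ M , m≤m⊔n (suc (f x)) M ∷ All.map (λ fy<M → <-≤-trans fy<M (m≤n⊔m _ M)) below

freshOfLength : ∀ (S : List (List ℕ)) d → ∃ λ t → length t ≡ suc d × All (_≢ t) S
freshOfLength S d with strictUpperBound sum S
... | M , below = M ∷ replicate d 0 , cong suc (length-replicate d) ,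
  All.map (λ {s} sum<M s≡t → <⇒≱ sum<M (subst (λ u → M ≤ sum u) (sym s≡t) (m≤m+n M _))) below

Agree : ℕ → Subset → Subset → Set
Agree L X Y = ∀ k → k < L → X k ≡ Y k

DeterminedBelow : ℕ → (Subset → Set) → Set
DeterminedBelow L C = ∀ X Y → Agree L X Y → C X → C Y

PrefixClosed : (Subset → Set) → Set
PrefixClosed C = ∀ X → ¬ C X → ∃ λ L → ∀ Y → Agree L X Y → ¬ C Y

initialSegment : Subset → ℕ → List Bool
initialSegment X zero = []
initialSegment X (suc L) = X 0 ∷ initialSegment (λ n → X (suc n)) L

initialSegment-≺ : ∀ X L → initialSegment X L ≺ X
initialSegment-≺ X zero = tt
initialSegment-≺ X (suc L) = refl , initialSegment-≺ (λ n → X (suc n)) L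

initialSegment-≺⇒Agree : ∀ X Y L → initialSegment X L ≺ Y → Agree L X Y
initialSegment-≺⇒Agree X Y (suc L) (Y0≡X0 , _) zero _ = sym Y0≡X0
initialSegment-≺⇒Agree X Y (suc L) (_ , tail≺) (suc k) (s≤s k<L) =
  initialSegment-≺⇒Agree (λ n → X (suc n)) (λ n → Y (suc n)) L tail≺ k k<L

prefixClosed⇒isClosed : ∀ {C} → PrefixClosed C → IsClosed C
prefixClosed⇒isClosed {C} closed = (λ s → ∀ Y → s ≺ Y → ¬ C Y) , λ X → mk⇔
  (λ ¬CX → let L , outside = closed X ¬CX
           in initialSegment X L ,
              (λ Y s≺Y → outside Y (initialSegment-≺⇒Agree X Y L s≺Y)) ,
              initialSegment-≺ X L)
  (λ { (s , outside , s≺X) → outside X s≺X })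

determinedBelow⇒prefixClosed : ∀ {C} L → DeterminedBelow L C → PrefixClosed C
determinedBelow⇒prefixClosed L determined X ¬CX =
  L , λ Y X≈Y CY → ¬CX (determined Y X (λ k k<L → sym (X≈Y k k<L)) CY)

length-∷ʳ : ∀ (s : List ℕ) n → length (s ∷ʳ n) ≡ suc (length s)
length-∷ʳ s n = trans (length-++ s) (+-comm (length s) 1)

module Classical (em : ExcludedMiddle 0ℓ) where

  ⟦_⟧ : (ℕ → Set) → Subset
  ⟦ P ⟧ k = does (em {P k})

  ∈⟦⟧⁺ : ∀ {P k} → P k → k ∈ ⟦ P ⟧
  ∈⟦⟧⁺ {P} {k} p with em {P k}
  ... | yes _ = refl
  ... | no ¬p = contradiction p ¬p

  ∈⟦⟧⁻ : ∀ {P k} → k ∈ ⟦ P ⟧ → P k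
  ∈⟦⟧⁻ {P} {k} k∈P with em {P k}
  ... | yes p = p

  ¬Infinite⇒Finite : ∀ {X} → ¬ Infinite X → Finite X
  ¬Infinite⇒Finite {X} ¬inf with em {Finite X}
  ... | yes fin = fin
  ... | no ¬fin = contradiction unbounded ¬inf
    where
    unbounded : Infinite X
    unbounded N with em {∃ λ n → N ≤ n × n ∈ X}
    ... | yes above = above
    ... | no ¬above =
      contradiction (N , λ k k∈X → ≰⇒> (λ N≤k → ¬above (k , N≤k , k∈X))) ¬fin

  frontier : ∀ (Q : List ℕ → Set) d → Q [] → (∀ t → length t ≡ d → ¬ Q t) →
             ∃ λ s → Q s × ∀ n → ¬ Q (s ∷ʳ n)
  frontier Q d Q[] ¬Q-at-d = descend d [] refl Q[]
    where
    descend : ∀ e s → length s + e ≡ d → Q s → ∃ λ s → Q s × ∀ n → ¬ Q (s ∷ʳ n)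
    descend zero s |s|≡d Qs = contradiction Qs (¬Q-at-d s (trans (sym (+-identityʳ _)) |s|≡d))
    descend (suc e) s |s|+1+e≡d Qs with em {∃ λ n → Q (s ∷ʳ n)}
    ... | yes (n , Qsn) = descend e (s ∷ʳ n) |sn|+e≡d Qsn
      where
      |sn|+e≡d : length (s ∷ʳ n) + e ≡ d
      |sn|+e≡d = trans (cong (_+ e) (length-∷ʳ s n)) (trans (sym (+-suc _ e)) |s|+1+e≡d)
    ... | no ∄n = s , Qs , λ n Qsn → ∄n (n , Qsn)

  maximal : ∀ {X : Set} {P : X → Set} (f : X → ℕ) xs → Any P xs →
            ∃ λ x → x ∈ˡ xs × P x × All (λ y → P y → f y ≤ f x) xs
  maximal {P = P} f (x ∷ xs) any with em {P x}
  maximal f (x ∷ xs) (here Px) | no ¬Px = contradiction Px ¬Px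
  maximal f (x ∷ xs) (there any) | no ¬Px =
    let y , y∈ , Py , max = maximal f xs any
    in y , there y∈ , Py , (λ Px → contradiction Px ¬Px) ∷ max
  ... | yes Px with em {Any _ xs}
  ...   | no ∄ = x , here refl , Px ,
                 (λ _ → ≤-refl) ∷ All.tabulate (λ y∈ Py → contradiction (lose y∈ Py) ∄)
  ...   | yes any′ with maximal f xs any′
  ...     | y , y∈ , Py , max with f x ≤? f y
  ...       | yes fx≤fy = y , there y∈ , Py , (λ _ → fx≤fy) ∷ max
  ...       | no fx≰fy = x , here refl , Px , (λ _ → ≤-refl) ∷
                           All.map (λ fz≤fy Pz → ≤-trans (fz≤fy Pz) (<⇒≤ (≰⇒> fx≰fy))) max

  prefixClosed-× : ∀ {C D} → PrefixClosed C → PrefixClosed D → PrefixClosed (λ X → C X × D X)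
  prefixClosed-× {C} closedC closedD X ¬CDX with em {C X}
  ... | yes CX = let L , outside = closedD X (λ DX → ¬CDX (CX , DX))
                 in L , λ Y X≈Y CDY → outside Y X≈Y (proj₂ CDY)
  ... | no ¬CX = let L , outside = closedC X ¬CX
                 in L , λ Y X≈Y CDY → outside Y X≈Y (proj₁ CDY)

  prefixClosed-Π : ∀ {I : Set} {C : I → Subset → Set} →
                   (∀ i → PrefixClosed (C i)) → PrefixClosed (λ X → ∀ i → C i X)
  prefixClosed-Π {I} {C} closed X ¬∀CX with em {∃ λ i → ¬ C i X}
  ... | yes (i , ¬CiX) = let L , outside = closed i X ¬CiX
                         in L , λ Y X≈Y ∀CY → outside Y X≈Y (∀CY i)
  ... | no ¬∃ = contradiction (λ i → decide i (em {C i X})) ¬∀CX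
    where
    decide : ∀ i → Dec (C i X) → C i X
    decide i (yes CiX) = CiX
    decide i (no ¬CiX) = contradiction (i , ¬CiX) ¬∃

module Tree (em : ExcludedMiddle 0ℓ) (A : Family) (T : IsTreeFamily A) where
  open IsTreeFamily T
  open Classical em

  infinite-∩-root : ∀ {X} → Infinite X → Infinite (X ∩ A [])
  infinite-∩-root {X} X-infinite N with X-infinite N
  ... | k , N≤k , k∈X = k , N≤k , ∈-∩⁺ {X} {A []} k∈X (root k)

  A-++-⊆ : ∀ s t → A (s ++ t) ⊆ A s
  A-++-⊆ s [] k k∈ = subst (λ u → k ∈ A u) (++-identityʳ s) k∈
  A-++-⊆ s (n ∷ t) k k∈ =
    sub s n k (A-++-⊆ (s ∷ʳ n) t k (subst (λ u → k ∈ A u) (sym (∷ʳ-++ s n t)) k∈))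

  sameLevel-≡ : ∀ {s t k} → length s ≡ length t → k ∈ A s → k ∈ A t → s ≡ t
  sameLevel-≡ {s} {t} = viaReverse (reverseView s) (reverseView t)
    where
    viaReverse : ∀ {s t k} → Reverse s → Reverse t →
                 length s ≡ length t → k ∈ A s → k ∈ A t → s ≡ t
    viaReverse [] [] _ _ _ = refl
    viaReverse [] (t ∶ _ ∶ʳ n) eq _ _ = contradiction (trans eq (length-∷ʳ t n)) (λ ())
    viaReverse (s ∶ _ ∶ʳ n) [] eq _ _ = contradiction (trans (sym eq) (length-∷ʳ s n)) (λ ())
    viaReverse {k = k} (s ∶ rs ∶ʳ n) (t ∶ rt ∶ʳ n') eq k∈sn k∈tn'
      with viaReverse rs rt (suc-injective (trans (sym (length-∷ʳ s n)) (trans eq (length-∷ʳ t n'))))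
                           (sub s n k k∈sn) (sub t n' k k∈tn')
    ... | refl = cong (s ∷ʳ_) (disjoint s n n' k k∈sn k∈tn')

  deeper-⊆-child : ∀ {r u k} → k ∈ A r → k ∈ A u → length r < length u →
                   ∃ λ c → A u ⊆ A (r ∷ʳ c)
  deeper-⊆-child {r} {u} = viaReverse (reverseView u)
    where
    viaReverse : ∀ {u k} → Reverse u → k ∈ A r → k ∈ A u → length r < length u →
                 ∃ λ c → A u ⊆ A (r ∷ʳ c)
    viaReverse [] _ _ ()
    viaReverse {k = k} (u ∶ ru ∶ʳ c) k∈r k∈uc r<uc
      with m≤n⇒m<n∨m≡n (≤-pred (subst (length r <_) (length-∷ʳ u c) r<uc))
    ... | inj₂ r≡u with sameLevel-≡ r≡u k∈r (sub u c k k∈uc)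
    ...   | refl = c , λ _ k′∈ → k′∈
    viaReverse {k = k} (u ∶ ru ∶ʳ c) k∈r k∈uc r<uc | inj₁ r<u
      with viaReverse ru k∈r (sub u c k k∈uc) r<u
    ... | c′ , u⊆rc′ = c′ , λ k′ k′∈uc → u⊆rc′ k′ (sub u c k′ k′∈uc)

  child : List ℕ → ℕ → ℕ
  child r k with em {∃ λ n → k ∈ A (r ∷ʳ n)}
  ... | yes (n , _) = n
  ... | no _ = 0

  child-∈ : ∀ r {k} → k ∈ A r → k ∈ A (r ∷ʳ child r k)
  child-∈ r {k} k∈r with em {∃ λ n → k ∈ A (r ∷ʳ n)}
  ... | yes (n , k∈rn) = k∈rn
  ... | no ∄n = contradiction (cover r k k∈r) ∄n

  child-unique : ∀ r {n k} → k ∈ A (r ∷ʳ n) → child r k ≡ n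
  child-unique r {n} {k} k∈rn = disjoint r (child r k) n k (child-∈ r (sub r n k k∈rn)) k∈rn

  InsideOneChild : List ℕ → Subset → Set
  InsideOneChild r P = ∀ k → k ∈ P → k ∈ A r → ∃ λ c → P ⊆ A (r ∷ʳ c)

  insideOneChild : ∀ {r u P} → P ⊆ A u → (∀ k → k ∈ P → k ∈ A r → length r < length u) →
                   InsideOneChild r P
  insideOneChild P⊆u deeper k k∈P k∈r with deeper-⊆-child k∈r (P⊆u k k∈P) (deeper k k∈P k∈r)
  ... | c , u⊆rc = c , λ k′ k′∈P → u⊆rc k′ (P⊆u k′ k′∈P)

  B-atMostOne : ∀ {Y P} (b : InB A Y) → InsideOneChild (proj₁ b) P → AtMostOne (Y ∩ P)
  B-atMostOne {Y} {P} (r , Y⊆r , one) inside a b a∈ b∈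
    with ∈-∩⁻ {Y} {P} a∈ | ∈-∩⁻ {Y} {P} b∈
  ... | a∈Y , a∈P | b∈Y , b∈P with inside a a∈P (Y⊆r a a∈Y)
  ... | c , P⊆rc with one c
  ... | _ , _ , unique = trans (unique a (∈-∩⁺ {Y} {A (r ∷ʳ c)} a∈Y (P⊆rc a a∈P)))
                               (sym (unique b (∈-∩⁺ {Y} {A (r ∷ʳ c)} b∈Y (P⊆rc b b∈P))))

  B-through : ∀ r (pick : ℕ → ℕ) → (∀ n → pick n ∈ A (r ∷ʳ n)) →
              ∃ λ Y → InB A Y × (∀ n → pick n ∈ Y)
  B-through r pick pick∈ = Y , (r , Y⊆r , exactlyOne) , pick∈Y
    where
    Picked : ℕ → Set
    Picked k = k ∈ A r × ∃ λ n → k ≡ pick n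
    Y : Subset
    Y = ⟦ Picked ⟧
    Y⊆r : Y ⊆ A r
    Y⊆r k k∈Y = proj₁ (∈⟦⟧⁻ {Picked} k∈Y)
    pick∈Y : ∀ n → pick n ∈ Y
    pick∈Y n = ∈⟦⟧⁺ {Picked} (sub r n (pick n) (pick∈ n) , n , refl)
    exactlyOne : ∀ n → ExactlyOne (Y ∩ A (r ∷ʳ n))
    exactlyOne n = pick n , ∈-∩⁺ {Y} {A (r ∷ʳ n)} (pick∈Y n) (pick∈ n) , λ k k∈ →
      let k∈Y , k∈rn = ∈-∩⁻ {Y} {A (r ∷ʳ n)} k∈
          _ , n′ , k≡pick-n′ = ∈⟦⟧⁻ {Picked} k∈Y
          k∈rn′ = subst (_∈ A (r ∷ʳ n′)) (sym k≡pick-n′) (pick∈ n′)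
      in trans k≡pick-n′ (cong pick (disjoint r n′ n k k∈rn′ k∈rn))

  B-meeting : ∀ r (Z : ℕ → ℕ → Set) → (∀ n k → Z n k → k ∈ A (r ∷ʳ n)) →
              ∃ λ Y → InB A Y × (∀ n k → Z n k → ∃ λ k′ → Z n k′ × k′ ∈ Y)
  B-meeting r Z Z⊆ =
    let Y , Y∈B , pick∈Y = B-through r pick (λ n → choice-∈ n em)
    in Y , Y∈B , λ n k z → pick n , choice-Z n em (k , z) , pick∈Y n
    where
    choice : ∀ n → Dec (∃ (Z n)) → ℕ
    choice n (yes (k , _)) = k
    choice n (no _) = proj₁ (infinite (r ∷ʳ n) 0)
    choice-∈ : ∀ n d → choice n d ∈ A (r ∷ʳ n)
    choice-∈ n (yes (k , z)) = Z⊆ n k z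
    choice-∈ n (no _) = proj₂ (proj₂ (infinite (r ∷ʳ n) 0))
    choice-Z : ∀ n d → ∃ (Z n) → Z n (choice n d)
    choice-Z n (yes (k , z)) _ = z
    choice-Z n (no ∄z) ∃z = contradiction ∃z ∄z
    pick : ℕ → ℕ
    pick n = choice n em

  B-infinite-below : ∀ {X s} → Infinite (X ∩ A s) → (∀ n → Finite (X ∩ A (s ∷ʳ n))) →
                     ∃ λ Y → InB A Y × Infinite (X ∩ Y)
  B-infinite-below {X} {s} inf finite =
    let Y , Y∈B , meets = B-meeting s (λ n k → k ∈ (X ∩ A (s ∷ʳ n)))
                                      (λ n k k∈ → proj₂ (∈-∩⁻ {X} {A (s ∷ʳ n)} k∈))
    in Y , Y∈B , λ N → above Y meets N
    where
    bound : ℕ → ℕ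
    bound n = proj₁ (finite n)
    -- M bounds X within the children of 0, …, N-1, so the child of e ≥ M holds no point of X below N
    above : ∀ Y → (∀ n k → k ∈ (X ∩ A (s ∷ʳ n)) →
                           ∃ λ k′ → k′ ∈ (X ∩ A (s ∷ʳ n)) × k′ ∈ Y) →
            ∀ N → ∃ λ p → N ≤ p × p ∈ (X ∩ Y)
    above Y meets N =
      let M , M-bounds = upperBound (λ k → bound (child s k)) N
          e , N⊔M≤e , e∈ = inf (N ⊔ M)
          e∈X , e∈s = ∈-∩⁻ {X} {A s} e∈
          c = child s e
          e∈c = ∈-∩⁺ {X} {A (s ∷ʳ c)} e∈X (child-∈ s e∈s)
          p , p∈ , p∈Y = meets c e e∈c
          p∈X , p∈c = ∈-∩⁻ {X} {A (s ∷ʳ c)} p∈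
          e<bound = proj₂ (finite c) e e∈c
          N≤p = ≮⇒≥ λ p<N → <⇒≱ e<bound (begin
            bound c           ≡⟨ cong bound (sym (child-unique s p∈c)) ⟩
            bound (child s p) ≤⟨ M-bounds p p<N ⟩
            M                 ≤⟨ m≤n⊔m N M ⟩
            N ⊔ M             ≤⟨ N⊔M≤e ⟩
            e                 ∎)
      in p , N≤p , ∈-∩⁺ {X} {Y} p∈X p∈Y
      where open ≤-Reasoning

module EDmProperties (em : ExcludedMiddle 0ℓ) (A : Family) (T : IsTreeFamily A) (m : ℕ) where
  open IsTreeFamily T using (infinite)
  open Classical em
  open Tree em A T

  levelNodes : ∀ {G} → All (Generator A m) G → List (List ℕ)
  levelNodes [] = []
  levelNodes (inj₁ (s , _) ∷ gs) = s ∷ levelNodes gs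
  levelNodes (inj₂ _ ∷ gs) = levelNodes gs

  bSetRoots : ∀ {G} → All (Generator A m) G → List (List ℕ)
  bSetRoots [] = []
  bSetRoots (inj₁ _ ∷ gs) = bSetRoots gs
  bSetRoots (inj₂ (r , _) ∷ gs) = r ∷ bSetRoots gs

  levelNodes-length : ∀ {G} (gs : All (Generator A m) G) → All (λ s → length s ≡ suc m) (levelNodes gs)
  levelNodes-length [] = []
  levelNodes-length (inj₁ (_ , |s| , _) ∷ gs) = |s| ∷ levelNodes-length gs
  levelNodes-length (inj₂ _ ∷ gs) = levelNodes-length gs

  generators-cover : ∀ {G k} (gs : All (Generator A m) G) → Any (k ∈_) G →
                     Any (λ s → k ∈ A s) (levelNodes gs) ⊎ Any (λ r → k ∈ A r) (bSetRoots gs)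
  generators-cover (inj₁ (s , _ , refl) ∷ gs) (here k∈s) = inj₁ (here k∈s)
  generators-cover {k = k} (inj₂ (r , Y⊆r , _) ∷ gs) (here k∈Y) = inj₂ (here (Y⊆r k k∈Y))
  generators-cover (inj₁ _ ∷ gs) (there k∈G) with generators-cover gs k∈G
  ... | inj₁ k∈S = inj₁ (there k∈S)
  ... | inj₂ k∈R = inj₂ k∈R
  generators-cover (inj₂ _ ∷ gs) (there k∈G) with generators-cover gs k∈G
  ... | inj₁ k∈S = inj₁ k∈S
  ... | inj₂ k∈R = inj₂ (there k∈R)

  generators-atMostOne : ∀ {G P} (gs : All (Generator A m) G) →
                         All (λ s → ∀ k → k ∈ P → k ∉ A s) (levelNodes gs) →
                         All (λ r → InsideOneChild r P) (bSetRoots gs) →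
                         All (λ g → AtMostOne (g ∩ P)) G
  generators-atMostOne [] _ _ = []
  generators-atMostOne {P = P} (inj₁ (s , _ , refl) ∷ gs) (avoids ∷ avoidsAll) inside =
    (λ a _ a∈ _ → let a∈s , a∈P = ∈-∩⁻ {A s} {P} a∈ in contradiction a∈s (avoids a a∈P))
    ∷ generators-atMostOne gs avoidsAll inside
  generators-atMostOne (inj₂ b ∷ gs) avoids (inside ∷ insideAll) =
    B-atMostOne b inside ∷ generators-atMostOne gs avoids insideAll

  generator∈EDm : ∀ {Y} → Generator A m Y → EDm A m Y
  generator∈EDm gen = _ ∷ [] , gen ∷ [] , 0 , λ k k∈Y → inj₂ (here k∈Y)

  EDm-downward : ∀ X Y → EDm A m Y → X ⊆ Y → EDm A m X
  EDm-downward X Y (G , gs , N , covered) X⊆Y = G , gs , N , λ k k∈X → covered k (X⊆Y k k∈X)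

  EDm-union : ∀ X Y → EDm A m X → EDm A m Y → EDm A m (X ∪ Y)
  EDm-union X Y (G , gs , N , coveredX) (G′ , gs′ , N′ , coveredY) =
    G ++ G′ , ++⁺ gs gs′ , N ⊔ N′ , covered
    where
    covered : ∀ k → k ∈ (X ∪ Y) → k < N ⊔ N′ ⊎ Any (k ∈_) (G ++ G′)
    covered k k∈X∪Y with X k in k∈X
    ... | true = Sum.map (λ k<N → <-≤-trans k<N (m≤m⊔n N N′)) ++⁺ˡ (coveredX k k∈X)
    ... | false = Sum.map (λ k<N′ → <-≤-trans k<N′ (m≤n⊔m N N′)) (++⁺ʳ G) (coveredY k k∈X∪Y)

  EDm-finite : ∀ X → Finite X → EDm A m X
  EDm-finite X (N , bounded) = [] , [] , N , λ k k∈X → inj₁ (bounded k k∈X)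

  EDm-proper : ¬ EDm A m full
  EDm-proper (G , gs , N , covered)
    with freshOfLength (levelNodes gs) m | strictUpperBound length (bSetRoots gs)
  ... | t , |t| , t-fresh | K , roots-short =
    infinite-uncoverable G P-infinite (generators-atMostOne gs avoids inside) P-covered
    where
    -- t is a node of length m + 1 other than the generating ones;
    -- u extends t and is longer than every generating root
    u = t ++ replicate K 0
    K≤|u| : K ≤ length u
    K≤|u| = ≤-trans (m≤n+m K (length t))
      (≤-reflexive (sym (trans (length-++ t) (cong (length t +_) (length-replicate K)))))
    InP : ℕ → Set
    InP k = k ∈ A u × N ≤ k
    P = ⟦ InP ⟧
    P⊆u : P ⊆ A u
    P⊆u k k∈P = proj₁ (∈⟦⟧⁻ {InP} k∈P)
    P-infinite : Infinite P
    P-infinite N′ with infinite u (N′ ⊔ N)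
    ... | k , N′⊔N≤k , k∈u =
      k , m⊔n≤o⇒m≤o N′ N N′⊔N≤k , ∈⟦⟧⁺ {InP} (k∈u , m⊔n≤o⇒n≤o N′ N N′⊔N≤k)
    P-covered : ∀ k → k ∈ P → Any (k ∈_) G
    P-covered k k∈P with covered k refl
    ... | inj₁ k<N = contradiction (proj₂ (∈⟦⟧⁻ {InP} k∈P)) (<⇒≱ k<N)
    ... | inj₂ k∈G = k∈G
    avoids : All (λ s → ∀ k → k ∈ P → k ∉ A s) (levelNodes gs)
    avoids = All.zipWith
      (λ (|s| , s≢t) k k∈P k∈s →
        s≢t (sameLevel-≡ (trans |s| (sym |t|)) k∈s (A-++-⊆ t _ k (P⊆u k k∈P))))
      (levelNodes-length gs , t-fresh)
    inside : All (λ r → InsideOneChild r P) (bSetRoots gs)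
    inside = All.map (λ |r|<K → insideOneChild P⊆u (λ _ _ _ → <-≤-trans |r|<K K≤|u|)) roots-short

  isIdeal : IsIdeal (EDm A m)
  isIdeal = record
    { downward = EDm-downward
    ; union = EDm-union
    ; finite = EDm-finite
    ; proper = EDm-proper
    }

  EDm-tall : Tall (EDm A m)
  EDm-tall X X-infinite with em {∃ λ s → length s ≡ suc m × Infinite (X ∩ A s)}
  ... | yes (s , |s| , X∩s-infinite) = A s , generator∈EDm (inj₁ (s , |s| , refl)) , X∩s-infinite
  ... | no ∄s with frontier (λ t → Infinite (X ∩ A t)) (suc m) (infinite-∩-root X-infinite)
                          (λ t |t| X∩t-infinite → ∄s (t , |t| , X∩t-infinite))
  ...   | s , X∩s-infinite , children-finite
          with B-infinite-below X∩s-infinite (λ n → ¬Infinite⇒Finite (children-finite n))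
  ...     | Y , Y∈B , X∩Y-infinite = Y , generator∈EDm (inj₂ Y∈B) , X∩Y-infinite

  Parameters : Set
  Parameters = ℕ × List (List ℕ) × List (List ℕ) × ℕ

  -- (N , S , R , j): X is covered by [0, N), the A s with s ∈ S, and j B-sets rooted at each r ∈ R
  record InResidue (N : ℕ) (S R : List (List ℕ)) (r : List ℕ) (n k : ℕ) : Set where
    field
      beyond  : N ≤ k
      outside : All (λ s → k ∉ A s) S
      inChild : k ∈ A (r ∷ʳ n)
      deepest : All (λ r′ → k ∈ A r′ → length r′ ≤ length r) R

  Residue : Parameters → List ℕ → ℕ → Subset
  Residue (N , S , R , _) r n = ⟦ InResidue N S R r n ⟧

  Certified : Parameters → Subset → Set
  Certified p@(N , S , R , j) X =
    All (λ s → length s ≡ suc m) S ×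
    (∀ k → k ∈ X → k < N ⊎ Any (λ s → k ∈ A s) S ⊎ Any (λ r → k ∈ A r) R) ×
    (∀ r → r ∈ˡ R → ∀ n L → count (X ∩ Residue p r n) L ≤ j)

  certified-prefixClosed : ∀ p → PrefixClosed (Certified p)
  certified-prefixClosed p@(N , S , R , j) =
    prefixClosed-× (determinedBelow⇒prefixClosed 0 (λ _ _ _ lengths → lengths))
   (prefixClosed-×
     (prefixClosed-Π λ k → determinedBelow⇒prefixClosed (suc k)
       (λ X Y X≈Y covered k∈Y → covered (trans (X≈Y k ≤-refl) k∈Y)))
     (prefixClosed-Π λ r → prefixClosed-Π λ _ → prefixClosed-Π λ n → prefixClosed-Π λ L →
       determinedBelow⇒prefixClosed L (λ X Y X≈Y bounded →
         subst (_≤ j) (count-ext L (λ k k<L → cong (_∧ Residue p r n k) (X≈Y k k<L))) bounded)))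

  EDm⇒certified : ∀ {X} → EDm A m X → ∃ λ p → Certified p X
  EDm⇒certified {X} (G , gs , N , covered) = p , levelNodes-length gs , cover , bounded
    where
    S = levelNodes gs
    R = bSetRoots gs
    p = N , S , R , length G
    cover : ∀ k → k ∈ X → k < N ⊎ Any (λ s → k ∈ A s) S ⊎ Any (λ r → k ∈ A r) R
    cover k k∈X = Sum.map₂ (generators-cover gs) (covered k k∈X)
    bounded : ∀ r → r ∈ˡ R → ∀ n L → count (X ∩ Residue p r n) L ≤ length G
    bounded r _ n = count-cover G (generators-atMostOne gs avoids inside) P-covered
      where
      P = X ∩ Residue p r n
      residue : ∀ {k} → k ∈ P → InResidue N S R r n k
      residue k∈P = ∈⟦⟧⁻ {InResidue N S R r n} (proj₂ (∈-∩⁻ {X} {Residue p r n} k∈P))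
      open InResidue
      P-covered : ∀ k → k ∈ P → Any (k ∈_) G
      P-covered k k∈P with covered k (proj₁ (∈-∩⁻ {X} {Residue p r n} k∈P))
      ... | inj₁ k<N = contradiction (beyond (residue k∈P)) (<⇒≱ k<N)
      ... | inj₂ k∈G = k∈G
      avoids : All (λ s → ∀ k → k ∈ P → k ∉ A s) S
      avoids = All.tabulate λ s∈S k k∈P → All.lookup (outside (residue k∈P)) s∈S
      inside : All (λ r′ → InsideOneChild r′ P) R
      inside = All.tabulate λ r′∈R → insideOneChild (λ k k∈P → inChild (residue k∈P))
        (λ k k∈P k∈r′ → subst (_ <_) (sym (length-∷ʳ r n))
                               (s≤s (All.lookup (deepest (residue k∈P)) r′∈R k∈r′)))

  certified⇒EDm : ∀ {p X} → Certified p X → EDm A m X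
  certified⇒EDm {p@(N , S , R , j)} {X} (lengths , cover , bounded) =
    map A S ++ map (uncurry B) (cartesianProduct R (upTo j)) ,
    ++⁺ (All-map⁺ (All.map (λ |s| → inj₁ (_ , |s| , refl)) lengths))
        (All-map⁺ (All.universal (λ (r , i) → inj₂ (proj₁ (proj₂ (meeting r i)))) _)) ,
    N , covered
    where
    D : List ℕ → ℕ → Subset
    D r n = X ∩ Residue p r n
    -- the i-th B-set rooted at r picks the point of rank i in each D r n
    Ranked : List ℕ → ℕ → ℕ → ℕ → Set
    Ranked r i n k = k ∈ D r n × count (D r n) k ≡ i
    meeting : ∀ r i → ∃ λ Y → InB A Y ×
                               (∀ n k → Ranked r i n k → ∃ λ k′ → Ranked r i n k′ × k′ ∈ Y)
    meeting r i = B-meeting r (Ranked r i) λ n k (k∈D , _) →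
      InResidue.inChild (∈⟦⟧⁻ {InResidue N S R r n} (proj₂ (∈-∩⁻ {X} {Residue p r n} k∈D)))
    B : List ℕ → ℕ → Subset
    B r i = proj₁ (meeting r i)
    inB : ∀ k → k ∈ X → ¬ k < N → ¬ Any (λ s → k ∈ A s) S → Any (λ r → k ∈ A r) R →
          Any (k ∈_) (map (uncurry B) (cartesianProduct R (upTo j)))
    inB k k∈X k≮N k∉S k∈R =
      let r , r∈R , k∈r , deepest = maximal length R k∈R
          n = child r k
          k∈D : k ∈ D r n
          k∈D = ∈-∩⁺ {X} {Residue p r n} k∈X (∈⟦⟧⁺ {InResidue N S R r n}
                  (record { beyond = ≮⇒≥ k≮N ; outside = ¬Any⇒All¬ S k∉S
                          ; inChild = child-∈ r k∈r ; deepest = deepest }))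
          c = count (D r n) k
          c<j : c < j
          c<j = subst (_≤ j) (count-suc-∈ (D r n) k∈D) (bounded r r∈R n (suc k))
          k′ , (k′∈D , rank) , k′∈B = proj₂ (proj₂ (meeting r c)) n k (k∈D , refl)
      in Any-map⁺ (lose (∈-cartesianProduct⁺ r∈R (∈-upTo⁺ c<j))
                        (subst (_∈ B r c) (count-injective k′∈D k∈D rank) k′∈B))
    covered : ∀ k → k ∈ X →
              k < N ⊎ Any (k ∈_) (map A S ++ map (uncurry B) (cartesianProduct R (upTo j)))
    covered k k∈X with cover k k∈X
    ... | inj₁ k<N = inj₁ k<N
    ... | inj₂ (inj₁ k∈S) = inj₂ (++⁺ˡ (Any-map⁺ k∈S))
    ... | inj₂ (inj₂ k∈R) with k <? N | em {Any (λ s → k ∈ A s) S}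
    ...   | yes k<N | _ = inj₁ k<N
    ...   | no _ | yes k∈S = inj₂ (++⁺ˡ (Any-map⁺ k∈S))
    ...   | no k≮N | no k∉S = inj₂ (++⁺ʳ (map A S) (inB k k∈X k≮N k∉S k∈R))

  enumerateParameters : ℕ ↠ Parameters
  enumerateParameters = ℕ↠-× (↠-id ℕ) (ℕ↠-× nodeLists (ℕ↠-× nodeLists (↠-id ℕ)))
    where
    nodeLists : ℕ ↠ List (List ℕ)
    nodeLists = ℕ↠-List (ℕ↠-List (↠-id ℕ))

  EDm-Fσ : IsFσ (EDm A m)
  EDm-Fσ = (λ k → Certified (to k)) , (λ k → prefixClosed⇒isClosed (certified-prefixClosed (to k))) ,
    λ X → mk⇔ (λ X∈EDm → let p , certified = EDm⇒certified X∈EDm in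
                         to⁻ p , subst (λ q → Certified q X) (sym (to∘to⁻ p)) certified)
              (λ (_ , certified) → certified⇒EDm certified)
    where open Surjection enumerateParameters using (to; to⁻; to∘to⁻)

proposition2p5 : ExcludedMiddle 0ℓ → (A : Family) → IsTreeFamily A → (m : ℕ) →
                 IsFσ (EDm A m) × IsIdeal (EDm A m) × Tall (EDm A m)
proposition2p5 em A T m = EDm-Fσ , isIdeal , EDm-tall
  where open EDmProperties em A T m
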